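{- Let $m,n$ be positive integers with $n\geq 2$ and $1\leq m\leq 4^{\lfloor n/2\rfloor}$. Then $\mathrm{rc}_2(K_{m,n,n})=2$.
   Context: Given an edge coloring $c:E(G)\to[\ell]$, a path is rainbow if no two of its edges receive the same color. $(G,c)$ is rainbow $k$-connected if every pair of distinct vertices is joined by $k$ pairwise internally disjoint rainbow paths. The rainbow $k$-connection number $\mathrm{rc}_k(G)$ is the minimum $\ell$ such that some coloring $c:E(G)\to[\ell]$ makes $(G,c)$ rainbow $k$-connected. $K_{m,n,n}$ denotes the complete tripartite graph with parts of sizes $m,n,n$. -}

module Defs where

open import Data.Nat using (ℕ; zero; suc; _+_; _<_; _<ᵇ_)
open import Data.Fin using (Fin; toℕ)
open import Data.Bool using (if_then_else_)
open import Data.List using (List; []; _∷_; _++_)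
open import Data.List.Relation.Unary.Unique.Propositional using (Unique)
open import Data.List.Relation.Unary.Linked using (Linked)
open import Data.List.Membership.Propositional using (_∈_; _∉_)
open import Data.Product using (Σ; _×_; ∃; _,_; proj₁)
open import Relation.Binary.PropositionalEquality using (_≡_; _≢_)
open import Relation.Nullary using (¬_)

record Graph : Set₁ where
  field
    V   : ℕ
    Adj : Fin V → Fin V → Set
open Graph public

tripPart : (a b c : ℕ) → Fin (a + b + c) → Fin 3
tripPart a b c i =
  if toℕ i <ᵇ a then Fin.zero
  else if toℕ i <ᵇ a + b then Fin.suc Fin.zero
  else Fin.suc (Fin.suc Fin.zero)

K3 : ℕ → ℕ → ℕ → Graph
K3 a b c = record
  { V   = a + b + c
  ; Adj = λ i j → tripPart a b c i ≢ tripPart a b c j }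

-- An edge colouring with ℓ colours: a colour for each (ordered) pair,
-- required to be symmetric on edges (so it is really a colouring of E(G));
-- values on non-adjacent pairs are irrelevant.
EdgeColouring : Graph → ℕ → Set
EdgeColouring G ℓ =
  Σ (Fin (V G) → Fin (V G) → Fin ℓ)
    λ c → ∀ u v → Adj G u v → c u v ≡ c v u

edgeColours : ∀ {n ℓ} → (Fin n → Fin n → Fin ℓ) → List (Fin n) → List (Fin ℓ)
edgeColours c []           = []
edgeColours c (x ∷ [])     = []
edgeColours c (x ∷ y ∷ xs) = c x y ∷ edgeColours c (y ∷ xs)

pathVerts : ∀ {n} → Fin n → List (Fin n) → Fin n → List (Fin n)
pathVerts u mid v = u ∷ (mid ++ (v ∷ []))

IsRainbowPath : (G : Graph) {ℓ : ℕ} → EdgeColouring G ℓ →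
                Fin (V G) → Fin (V G) → List (Fin (V G)) → Set
IsRainbowPath G (c , _) u v mid =
  Unique (pathVerts u mid v)
  × Linked (Adj G) (pathVerts u mid v)
  × Unique (edgeColours c (pathVerts u mid v))

InternallyDisjoint : ∀ {n} → List (Fin n) → List (Fin n) → Set
InternallyDisjoint p q = (p ≢ q) × (∀ x → x ∈ p → x ∉ q)

RainbowKConnected : (G : Graph) {ℓ : ℕ} → ℕ → EdgeColouring G ℓ → Set
RainbowKConnected G k c =
  ∀ (u v : Fin (V G)) → u ≢ v →
    Σ (Fin k → List (Fin (V G))) λ P →
      (∀ i → IsRainbowPath G c u v (P i)) ×
      (∀ i j → i ≢ j → InternallyDisjoint (P i) (P j))

RainbowKColourable : Graph → ℕ → ℕ → Set
RainbowKColourable G k ℓ = Σ (EdgeColouring G ℓ) (RainbowKConnected G k)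

RCk≡ : ℕ → Graph → ℕ → Set
RCk≡ k G ℓ = RainbowKColourable G k ℓ × (∀ ℓ' → ℓ' < ℓ → ¬ RainbowKColourable G k ℓ')

-- Write h = ⌊n/2⌋ and give the vertices a₀, …, a_{m-1} of the small part distinct words of h
-- base-4 digits, each digit read as a pair of bits.  Index both parts of size n by Fin n and let
-- index i read position i mod h: the edge aₖbᵢ gets the first and aₖcᵢ the second bit of that
-- digit of the word of k, while bᵢcⱼ gets colour 1 exactly when i = j.  Two a-vertices differ in
-- some bit at some position t, which is read by the two distinct indices t and t + h of one part,
-- giving two rainbow paths of length 2; bᵢ and bᵢ′ are joined through cᵢ and cᵢ′, and
-- symmetrically for two c-vertices.  Every remaining pair is an edge and needs one rainbow
-- detour: through a vertex where the diagonal colouring disagrees with the relevant bit, or,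
-- between bᵢ and cⱼ, through the vertex with the all-zero word.  With one colour a rainbow path
-- is a single edge, so two internally disjoint ones cannot exist.
module Submission where

open import Defs
open import Data.Nat using (ℕ; _≤_; _^_; _/_)
open import Data.Nat.Base
  using (zero; suc; _+_; _*_; _<_; _<ᵇ_; _%_; z≤n; s≤s; NonZero; >-nonZero; >-nonZero⁻¹)
open import Data.Nat.Properties
  using (≤-refl; ≤-trans; <-≤-trans; <⇒≢; ≤⇒≯; <ᵇ⇒<; <⇒<ᵇ; m≤m+n; m<m+n; +-monoˡ-<; +-monoʳ-<;
         +-identityʳ; *-comm)
  renaming (_≟_ to _≟ℕ_)
open import Data.Nat.DivMod
  using (_mod_; m%n<n; m≡m%n+[m/n]*n; m<n*o⇒m/o<n; [m+n]%n≡m%n; m<n⇒m%n≡m; m/n*n≤m; m≥n⇒m/n>0)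
open import Data.Fin.Base using (Fin; zero; suc; toℕ; fromℕ<; _↑ˡ_; _↑ʳ_; splitAt)
open import Data.Fin.Patterns using (0F; 1F; 2F; 3F)
open import Data.Fin.Properties
  using (_≟_; toℕ<n; toℕ-injective; toℕ-fromℕ<; fromℕ<-injective; toℕ-↑ˡ; toℕ-↑ʳ;
         splitAt-↑ˡ; splitAt-↑ʳ; splitAt⁻¹-↑ˡ; splitAt⁻¹-↑ʳ; 2↔Bool)
open import Data.Bool.Base using (Bool; true; false; T)
open import Data.Bool.Properties using () renaming (_≟_ to _≟ᵇ_)
open import Data.List.Base using (List; []; _∷_)
open import Data.List.Relation.Unary.AllPairs using ([]; _∷_)
open import Data.List.Relation.Unary.All using ([]; _∷_)
open import Data.List.Relation.Unary.Any using (here)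
open import Data.List.Relation.Unary.Linked using ([-]; _∷_)
open import Data.List.Relation.Unary.Unique.Propositional using (Unique)
open import Data.Product.Base using (Σ; ∃; ∃₂; _×_; _,_; proj₁; proj₂)
open import Data.Sum.Base using (_⊎_; inj₁; inj₂; [_,_]′)
open import Data.Unit.Base using (tt)
open import Data.Empty using (⊥-elim)
open import Function.Base using (_∘_)
open import Function.Bundles using (Inverse)
open import Relation.Binary.Definitions using (DecidableEquality)
open import Relation.Binary.PropositionalEquality
open import Relation.Nullary using (¬_; yes; no; does)
open import Relation.Nullary.Decidable using (dec-true; dec-false)

module RainbowPaths (G : Graph) {ℓ : ℕ} (c : EdgeColouring G ℓ)
                    (loopless : ∀ {u v} → Adj G u v → u ≢ v) where

  TwoRainbowPaths : Fin (V G) → Fin (V G) → Set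
  TwoRainbowPaths u v =
    Σ (Fin 2 → List (Fin (V G))) λ P →
      (∀ i → IsRainbowPath G c u v (P i)) ×
      (∀ i j → i ≢ j → InternallyDisjoint (P i) (P j))

  record Detour (u v w : Fin (V G)) : Set where
    constructor detour
    field
      adjacent₁ : Adj G u w
      adjacent₂ : Adj G w v
      colours≢  : proj₁ c u w ≢ proj₁ c w v

  edge-isRainbow : ∀ {u v} → Adj G u v → IsRainbowPath G c u v []
  edge-isRainbow u~v = ((loopless u~v ∷ []) ∷ [] ∷ []) , (u~v ∷ [-]) , ([] ∷ [])

  detour-isRainbow : ∀ {u v w} → u ≢ v → Detour u v w → IsRainbowPath G c u v (w ∷ [])
  detour-isRainbow u≢v (detour u~w w~v colours≢) =
    ((loopless u~w ∷ u≢v ∷ []) ∷ (loopless w~v ∷ []) ∷ [] ∷ []) ,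
    (u~w ∷ w~v ∷ [-]) ,
    ((colours≢ ∷ []) ∷ [] ∷ [])

  twoRainbowPaths : ∀ {u v} (P Q : List (Fin (V G))) →
                    IsRainbowPath G c u v P → IsRainbowPath G c u v Q →
                    InternallyDisjoint P Q → TwoRainbowPaths u v
  twoRainbowPaths {u} {v} P Q P-rainbow Q-rainbow (P≢Q , P∩Q) = paths , rainbow , disjoint
    where
    paths : Fin 2 → List (Fin (V G))
    paths zero    = P
    paths (suc _) = Q

    rainbow : ∀ i → IsRainbowPath G c u v (paths i)
    rainbow zero    = P-rainbow
    rainbow (suc _) = Q-rainbow

    disjoint : ∀ i j → i ≢ j → InternallyDisjoint (paths i) (paths j)
    disjoint 0F 0F 0≢0 = ⊥-elim (0≢0 refl)
    disjoint 0F 1F _   = P≢Q , P∩Q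
    disjoint 1F 0F _   = ≢-sym P≢Q , λ x x∈Q x∈P → P∩Q x x∈P x∈Q
    disjoint 1F 1F 1≢1 = ⊥-elim (1≢1 refl)

  edge-and-detour : ∀ {u v w} → Adj G u v → Detour u v w → TwoRainbowPaths u v
  edge-and-detour u~v d =
    twoRainbowPaths [] (_ ∷ []) (edge-isRainbow u~v) (detour-isRainbow (loopless u~v) d)
      ((λ ()) , λ _ ())

  two-detours : ∀ {u v w₁ w₂} → u ≢ v → w₁ ≢ w₂ →
                Detour u v w₁ → Detour u v w₂ → TwoRainbowPaths u v
  two-detours u≢v w₁≢w₂ d₁ d₂ =
    twoRainbowPaths (_ ∷ []) (_ ∷ []) (detour-isRainbow u≢v d₁) (detour-isRainbow u≢v d₂)
      ((λ { refl → w₁≢w₂ refl }) , λ { _ (here refl) (here w₁≡w₂) → w₁≢w₂ w₁≡w₂ })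

Fin1-irrelevant : (i j : Fin 1) → i ≡ j
Fin1-irrelevant zero zero = refl

monochromatic-rainbowPath-isEdge : ∀ {n} (c : Fin n → Fin n → Fin 1) u v mid →
                                   Unique (edgeColours c (pathVerts u mid v)) → mid ≡ []
monochromatic-rainbowPath-isEdge c u v []          _              = refl
monochromatic-rainbowPath-isEdge c u v (_ ∷ [])    ((c≢ ∷ _) ∷ _) = ⊥-elim (c≢ (Fin1-irrelevant _ _))
monochromatic-rainbowPath-isEdge c u v (_ ∷ _ ∷ _) ((c≢ ∷ _) ∷ _) = ⊥-elim (c≢ (Fin1-irrelevant _ _))

ℓ<2⇒¬RainbowKColourable : ∀ {G k ℓ} {u v : Fin (V G)} → u ≢ v → 2 ≤ k → ℓ < 2 →
                          ¬ RainbowKColourable G k ℓ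
ℓ<2⇒¬RainbowKColourable {u = u} _ _ (s≤s z≤n) ((c , _) , _) with c u u
... | ()
ℓ<2⇒¬RainbowKColourable {u = u} {v} u≢v (s≤s (s≤s _)) (s≤s (s≤s z≤n)) ((c , _) , connected)
  with connected u v u≢v
... | P , rainbow , disjoint =
  proj₁ (disjoint 0F 1F λ ()) (trans (isEdge 0F) (sym (isEdge 1F)))
  where
  isEdge : ∀ i → P i ≡ []
  isEdge i = monochromatic-rainbowPath-isEdge c u v (P i) (proj₂ (proj₂ (rainbow i)))

<⇒<ᵇ≡true : ∀ {x y} → x < y → (x <ᵇ y) ≡ true
<⇒<ᵇ≡true {x} {y} x<y with x <ᵇ y | <⇒<ᵇ x<y
... | true | _ = refl

≤⇒<ᵇ≡false : ∀ {x y} → y ≤ x → (x <ᵇ y) ≡ false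
≤⇒<ᵇ≡false {x} {y} y≤x with x <ᵇ y in eq
... | false = refl
... | true  = ⊥-elim (≤⇒≯ y≤x (<ᵇ⇒< x y (subst T (sym eq) tt)))

module Tripartite (m n : ℕ) where

  data Vertex : Set where
    a   : Fin m → Vertex
    b c : Fin n → Vertex

  side : Vertex → Fin 3
  side (a _) = 0F
  side (b _) = 1F
  side (c _) = 2F

  toFin : Vertex → Fin (m + n + n)
  toFin (a k) = (k ↑ˡ n) ↑ˡ n
  toFin (b i) = (m ↑ʳ i) ↑ˡ n
  toFin (c j) = (m + n) ↑ʳ j

  vertex : Fin (m + n + n) → Vertex
  vertex u = [ [ a , b ]′ ∘ splitAt m , c ]′ (splitAt (m + n) u)

  vertex-toFin : ∀ x → vertex (toFin x) ≡ x
  vertex-toFin (a k) rewrite splitAt-↑ˡ (m + n) (k ↑ˡ n) n | splitAt-↑ˡ m k n = refl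
  vertex-toFin (b i) rewrite splitAt-↑ˡ (m + n) (m ↑ʳ i) n | splitAt-↑ʳ m n i = refl
  vertex-toFin (c j) rewrite splitAt-↑ʳ (m + n) n j = refl

  toFin-vertex : ∀ u → toFin (vertex u) ≡ u
  toFin-vertex u with splitAt (m + n) u in eq
  ... | inj₂ j = splitAt⁻¹-↑ʳ eq
  ... | inj₁ x with splitAt m x in eq′
  ...   | inj₁ k = trans (cong (_↑ˡ n) (splitAt⁻¹-↑ˡ eq′)) (splitAt⁻¹-↑ˡ eq)
  ...   | inj₂ i = trans (cong (_↑ˡ n) (splitAt⁻¹-↑ʳ eq′)) (splitAt⁻¹-↑ˡ eq)

  toFin-≢ : ∀ {x y} → x ≢ y → toFin x ≢ toFin y
  toFin-≢ {x} {y} x≢y eq =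
    x≢y (trans (sym (vertex-toFin x)) (trans (cong vertex eq) (vertex-toFin y)))

  vertex-≢ : ∀ {u v} → u ≢ v → vertex u ≢ vertex v
  vertex-≢ {u} {v} u≢v eq =
    u≢v (trans (sym (toFin-vertex u)) (trans (cong toFin eq) (toFin-vertex v)))

  tripPart-toFin : ∀ x → tripPart m n n (toFin x) ≡ side x
  tripPart-toFin (a k)
    rewrite toℕ-↑ˡ (k ↑ˡ n) n | toℕ-↑ˡ k n | <⇒<ᵇ≡true (toℕ<n k) = refl
  tripPart-toFin (b i)
    rewrite toℕ-↑ˡ (m ↑ʳ i) n | toℕ-↑ʳ m i
          | ≤⇒<ᵇ≡false (m≤m+n m (toℕ i)) | <⇒<ᵇ≡true (+-monoʳ-< m (toℕ<n i)) = refl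
  tripPart-toFin (c j)
    rewrite toℕ-↑ʳ (m + n) j
          | ≤⇒<ᵇ≡false (≤-trans (m≤m+n m n) (m≤m+n (m + n) (toℕ j)))
          | ≤⇒<ᵇ≡false (m≤m+n (m + n) (toℕ j)) = refl

  adjacent : ∀ x y → side x ≢ side y → Adj (K3 m n n) (toFin x) (toFin y)
  adjacent x y sides≢ eq =
    sides≢ (trans (sym (tripPart-toFin x)) (trans eq (tripPart-toFin y)))

  loopless : ∀ {u v} → Adj (K3 m n n) u v → u ≢ v
  loopless u~v refl = u~v refl

×-≢ : ∀ {A B : Set} → DecidableEquality A → {p q : A × B} →
      p ≢ q → proj₁ p ≢ proj₁ q ⊎ proj₂ p ≢ proj₂ q
×-≢ _≟A_ {p} {q} p≢q with proj₁ p ≟A proj₁ q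
... | no  ≢₁ = inj₁ ≢₁
... | yes ≡₁ = inj₂ λ ≡₂ → p≢q (cong₂ _,_ ≡₁ ≡₂)

diagonal≢offDiagonal : ∀ {n} (k : Fin n) {i j : Fin n} → i ≢ j → does (k ≟ k) ≢ does (i ≟ j)
diagonal≢offDiagonal k {i} {j} i≢j =
  subst₂ _≢_ (sym (dec-true (k ≟ k) refl)) (sym (dec-false (i ≟ j) i≢j)) λ ()

fromBool : Bool → Fin 2
fromBool = Inverse.from 2↔Bool

fromBool-injective : ∀ {x y} → fromBool x ≡ fromBool y → x ≡ y
fromBool-injective {false} {false} _ = refl
fromBool-injective {true}  {true}  _ = refl

module TwoColouring
  {m n h : ℕ}
  (code : Fin m → Fin h → Bool × Bool)
  (code-separates : ∀ {k k′} → k ≢ k′ → ∃ λ t → code k t ≢ code k′ t)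
  (k₀ : Fin m) (code-k₀ : ∀ t → code k₀ t ≡ (false , true))
  (pos : Fin n → Fin h)
  (pos-fibres : ∀ t → ∃₂ λ i i′ → i ≢ i′ × pos i ≡ t × pos i′ ≡ t)
  where

  open Tripartite m n

  colour : Vertex → Vertex → Bool
  colour (a k) (b i) = proj₁ (code k (pos i))
  colour (a k) (c j) = proj₂ (code k (pos j))
  colour (b i) (a k) = proj₁ (code k (pos i))
  colour (b i) (c j) = does (i ≟ j)
  colour (c j) (a k) = proj₂ (code k (pos j))
  colour (c j) (b i) = does (i ≟ j)
  colour _     _     = false

  colour-sym : ∀ x y → colour x y ≡ colour y x
  colour-sym (a _) (a _) = refl
  colour-sym (a _) (b _) = refl
  colour-sym (a _) (c _) = refl
  colour-sym (b _) (a _) = refl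
  colour-sym (b _) (b _) = refl
  colour-sym (b _) (c _) = refl
  colour-sym (c _) (a _) = refl
  colour-sym (c _) (b _) = refl
  colour-sym (c _) (c _) = refl

  colouring : EdgeColouring (K3 m n n) 2
  colouring = (λ u v → fromBool (colour (vertex u) (vertex v))) ,
              (λ u v _ → cong fromBool (colour-sym (vertex u) (vertex v)))

  colouring-toFin : ∀ x y → proj₁ colouring (toFin x) (toFin y) ≡ fromBool (colour x y)
  colouring-toFin x y = cong₂ (λ x′ y′ → fromBool (colour x′ y′)) (vertex-toFin x) (vertex-toFin y)

  open RainbowPaths (K3 m n n) colouring loopless

  via : ∀ x y z → side x ≢ side z → side z ≢ side y → colour x z ≢ colour z y →
        Detour (toFin x) (toFin y) (toFin z)
  via x y z xz zy colours≢ = detour (adjacent x z xz) (adjacent z y zy) λ eq →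
    colours≢ (fromBool-injective
      (trans (sym (colouring-toFin x z)) (trans eq (colouring-toFin z y))))

  twin : ∀ i → ∃ λ j → j ≢ i × pos j ≡ pos i
  twin i with pos-fibres (pos i)
  ... | i₁ , i₂ , i₁≢i₂ , pos-i₁ , pos-i₂ with i₁ ≟ i
  ...   | yes refl = i₂ , ≢-sym i₁≢i₂ , pos-i₂
  ...   | no  i₁≢i = i₁ , i₁≢i , pos-i₁

  offDiagonal-witness : (g : Fin h → Bool) (i : Fin n) →
                        ∃ λ j → g (pos j) ≢ does (i ≟ j) × g (pos j) ≢ does (j ≟ i)
  offDiagonal-witness g i with g (pos i) in g-i
  ... | false = i , ≢diagonal , ≢diagonal
    where
    ≢diagonal : g (pos i) ≢ does (i ≟ i)
    ≢diagonal = subst₂ _≢_ (sym g-i) (sym (dec-true (i ≟ i) refl)) λ ()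
  ... | true with twin i
  ...   | j , j≢i , pos-j = j , ≢offDiagonal (≢-sym j≢i) , ≢offDiagonal j≢i
    where
    ≢offDiagonal : ∀ {i₁ i₂} → i₁ ≢ i₂ → g (pos j) ≢ does (i₁ ≟ i₂)
    ≢offDiagonal {i₁} {i₂} i₁≢i₂ =
      subst₂ _≢_ (sym (trans (cong g pos-j) g-i)) (sym (dec-false (i₁ ≟ i₂) i₁≢i₂)) λ ()

  k₀-separates-b-c : ∀ i j → proj₁ (code k₀ (pos i)) ≢ proj₂ (code k₀ (pos j))
  k₀-separates-b-c i j =
    subst₂ _≢_ (sym (cong proj₁ (code-k₀ (pos i)))) (sym (cong proj₂ (code-k₀ (pos j)))) λ ()

  twoRainbowPaths-via-b : ∀ {k k′} t → k ≢ k′ → proj₁ (code k t) ≢ proj₁ (code k′ t) →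
                          TwoRainbowPaths (toFin (a k)) (toFin (a k′))
  twoRainbowPaths-via-b {k} {k′} t k≢k′ bits≢ with pos-fibres t
  ... | i , i′ , i≢i′ , pos-i , pos-i′ =
    two-detours (toFin-≢ {a k} {a k′} λ { refl → k≢k′ refl })
                (toFin-≢ {b i} {b i′} λ { refl → i≢i′ refl })
                (via-b i pos-i) (via-b i′ pos-i′)
    where
    via-b : ∀ i → pos i ≡ t → Detour (toFin (a k)) (toFin (a k′)) (toFin (b i))
    via-b i pos-i = via (a k) (a k′) (b i) (λ ()) (λ ())
      (subst (λ s → proj₁ (code k s) ≢ proj₁ (code k′ s)) (sym pos-i) bits≢)

  twoRainbowPaths-via-c : ∀ {k k′} t → k ≢ k′ → proj₂ (code k t) ≢ proj₂ (code k′ t) →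
                          TwoRainbowPaths (toFin (a k)) (toFin (a k′))
  twoRainbowPaths-via-c {k} {k′} t k≢k′ bits≢ with pos-fibres t
  ... | j , j′ , j≢j′ , pos-j , pos-j′ =
    two-detours (toFin-≢ {a k} {a k′} λ { refl → k≢k′ refl })
                (toFin-≢ {c j} {c j′} λ { refl → j≢j′ refl })
                (via-c j pos-j) (via-c j′ pos-j′)
    where
    via-c : ∀ j → pos j ≡ t → Detour (toFin (a k)) (toFin (a k′)) (toFin (c j))
    via-c j pos-j = via (a k) (a k′) (c j) (λ ()) (λ ())
      (subst (λ s → proj₂ (code k s) ≢ proj₂ (code k′ s)) (sym pos-j) bits≢)

  twoRainbowPaths-aa : ∀ {k k′} → k ≢ k′ → TwoRainbowPaths (toFin (a k)) (toFin (a k′))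
  twoRainbowPaths-aa k≢k′ with code-separates k≢k′
  ... | t , codes≢ =
    [ twoRainbowPaths-via-b t k≢k′ , twoRainbowPaths-via-c t k≢k′ ]′ (×-≢ _≟ᵇ_ codes≢)

  twoRainbowPaths-bb : ∀ {i i′} → i ≢ i′ → TwoRainbowPaths (toFin (b i)) (toFin (b i′))
  twoRainbowPaths-bb {i} {i′} i≢i′ =
    two-detours (toFin-≢ {b i} {b i′} λ { refl → i≢i′ refl })
                (toFin-≢ {c i} {c i′} λ { refl → i≢i′ refl })
      (via (b i) (b i′) (c i)  (λ ()) (λ ()) (diagonal≢offDiagonal i (≢-sym i≢i′)))
      (via (b i) (b i′) (c i′) (λ ()) (λ ()) (≢-sym (diagonal≢offDiagonal i′ i≢i′)))

  twoRainbowPaths-cc : ∀ {j j′} → j ≢ j′ → TwoRainbowPaths (toFin (c j)) (toFin (c j′))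
  twoRainbowPaths-cc {j} {j′} j≢j′ =
    two-detours (toFin-≢ {c j} {c j′} λ { refl → j≢j′ refl })
                (toFin-≢ {b j} {b j′} λ { refl → j≢j′ refl })
      (via (c j) (c j′) (b j)  (λ ()) (λ ()) (diagonal≢offDiagonal j j≢j′))
      (via (c j) (c j′) (b j′) (λ ()) (λ ()) (≢-sym (diagonal≢offDiagonal j′ (≢-sym j≢j′))))

  twoRainbowPaths-distinct : ∀ x y → x ≢ y → TwoRainbowPaths (toFin x) (toFin y)
  twoRainbowPaths-distinct (a k) (a k′) x≢y = twoRainbowPaths-aa λ { refl → x≢y refl }
  twoRainbowPaths-distinct (b i) (b i′) x≢y = twoRainbowPaths-bb λ { refl → x≢y refl }
  twoRainbowPaths-distinct (c j) (c j′) x≢y = twoRainbowPaths-cc λ { refl → x≢y refl }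
  twoRainbowPaths-distinct (a k) (b i) _ with offDiagonal-witness (proj₂ ∘ code k) i
  ... | j , ≢cb , _ =
    edge-and-detour (adjacent (a k) (b i) λ ()) (via (a k) (b i) (c j) (λ ()) (λ ()) ≢cb)
  twoRainbowPaths-distinct (b i) (a k) _ with offDiagonal-witness (proj₂ ∘ code k) i
  ... | j , ≢cb , _ =
    edge-and-detour (adjacent (b i) (a k) λ ()) (via (b i) (a k) (c j) (λ ()) (λ ()) (≢-sym ≢cb))
  twoRainbowPaths-distinct (a k) (c j) _ with offDiagonal-witness (proj₁ ∘ code k) j
  ... | i , _ , ≢bc =
    edge-and-detour (adjacent (a k) (c j) λ ()) (via (a k) (c j) (b i) (λ ()) (λ ()) ≢bc)
  twoRainbowPaths-distinct (c j) (a k) _ with offDiagonal-witness (proj₁ ∘ code k) j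
  ... | i , _ , ≢bc =
    edge-and-detour (adjacent (c j) (a k) λ ()) (via (c j) (a k) (b i) (λ ()) (λ ()) (≢-sym ≢bc))
  twoRainbowPaths-distinct (b i) (c j) _ =
    edge-and-detour (adjacent (b i) (c j) λ ())
      (via (b i) (c j) (a k₀) (λ ()) (λ ()) (k₀-separates-b-c i j))
  twoRainbowPaths-distinct (c j) (b i) _ =
    edge-and-detour (adjacent (c j) (b i) λ ())
      (via (c j) (b i) (a k₀) (λ ()) (λ ()) (≢-sym (k₀-separates-b-c i j)))

  rainbow2Connected : RainbowKConnected (K3 m n n) 2 colouring
  rainbow2Connected u v u≢v =
    subst₂ TwoRainbowPaths (toFin-vertex u) (toFin-vertex v)
      (twoRainbowPaths-distinct (vertex u) (vertex v) (vertex-≢ u≢v))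

digit : ∀ b .{{_ : NonZero b}} → ℕ → ℕ → Fin b
digit b k zero    = k mod b
digit b k (suc t) = digit b (k / b) t

digit-zero : ∀ b t → digit (suc b) 0 t ≡ zero
digit-zero b zero    = refl
digit-zero b (suc t) = digit-zero b t

%-/-injective : ∀ {k k′ b} .{{_ : NonZero b}} → k % b ≡ k′ % b → k / b ≡ k′ / b → k ≡ k′
%-/-injective {k} {k′} {b} %≡ /≡ = begin
  k                   ≡⟨ m≡m%n+[m/n]*n k b ⟩
  k % b + k / b * b   ≡⟨ cong₂ (λ r q → r + q * b) %≡ /≡ ⟩
  k′ % b + k′ / b * b ≡⟨ m≡m%n+[m/n]*n k′ b ⟨
  k′                  ∎
  where open ≡-Reasoning

m<n^[1+o]⇒m/n<n^o : ∀ {m n} o .{{_ : NonZero n}} → m < n ^ suc o → m / n < n ^ o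
m<n^[1+o]⇒m/n<n^o {m} {n} o m<n^[1+o] =
  m<n*o⇒m/o<n (subst (m <_) (*-comm n (n ^ o)) m<n^[1+o])

digits-separate : ∀ {b} .{{_ : NonZero b}} h {k k′} → k < b ^ h → k′ < b ^ h → k ≢ k′ →
                  ∃ λ (t : Fin h) → digit b k (toℕ t) ≢ digit b k′ (toℕ t)
digits-separate zero (s≤s z≤n) (s≤s z≤n) 0≢0 = ⊥-elim (0≢0 refl)
digits-separate {b} (suc h) {k} {k′} k< k′< k≢k′ with k % b ≟ℕ k′ % b
... | no  %≢ = zero , %≢ ∘ fromℕ<-injective _ _ (m%n<n k b) (m%n<n k′ b)
... | yes %≡ with digits-separate h (m<n^[1+o]⇒m/n<n^o h k<) (m<n^[1+o]⇒m/n<n^o h k′<)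
                                  (k≢k′ ∘ %-/-injective %≡)
...   | t , digit≢ = suc t , digit≢

-- The digit 0 becomes (false , true), so that the all-zero word separates B from C.
bits : Fin 4 → Bool × Bool
bits 0F = false , true
bits 1F = true  , true
bits 2F = false , false
bits 3F = true  , false

bits-injective : ∀ {d d′} → bits d ≡ bits d′ → d ≡ d′
bits-injective {d} {d′} eq = trans (sym (unbits-bits d)) (trans (cong unbits eq) (unbits-bits d′))
  where
  unbits : Bool × Bool → Fin 4
  unbits (false , true)  = 0F
  unbits (true  , true)  = 1F
  unbits (false , false) = 2F
  unbits (true  , false) = 3F

  unbits-bits : ∀ d → unbits (bits d) ≡ d
  unbits-bits 0F = refl
  unbits-bits 1F = refl
  unbits-bits 2F = refl
  unbits-bits 3F = refl

base4Code : ∀ {m} h → Fin m → Fin h → Bool × Bool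
base4Code h k t = bits (digit 4 (toℕ k) (toℕ t))

base4Code-separates : ∀ {m h} → m ≤ 4 ^ h → ∀ {k k′ : Fin m} → k ≢ k′ →
                      ∃ λ t → base4Code h k t ≢ base4Code h k′ t
base4Code-separates {h = h} m≤4^h {k} {k′} k≢k′
  with digits-separate h (<-≤-trans (toℕ<n k) m≤4^h) (<-≤-trans (toℕ<n k′) m≤4^h)
                         (k≢k′ ∘ toℕ-injective)
... | t , digit≢ = t , digit≢ ∘ bits-injective

base4Code-zero : ∀ {m} h t → base4Code {suc m} h zero t ≡ (false , true)
base4Code-zero h t = cong bits (digit-zero 3 (toℕ t))

mod-fibres : ∀ {n h} .{{_ : NonZero h}} → h + h ≤ n →
             ∀ t → ∃₂ λ (i i′ : Fin n) → i ≢ i′ × toℕ i mod h ≡ t × toℕ i′ mod h ≡ t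
mod-fibres {n} {h} h+h≤n t =
  fromℕ< t<n , fromℕ< t+h<n ,
  (λ eq → <⇒≢ (m<m+n (toℕ t) (>-nonZero⁻¹ h)) (fromℕ<-injective _ _ t<n t+h<n eq)) ,
  mod≡ (cong (_% h) (toℕ-fromℕ< t<n)) ,
  mod≡ (trans (cong (_% h) (toℕ-fromℕ< t+h<n)) ([m+n]%n≡m%n (toℕ t) h))
  where
  t<n : toℕ t < n
  t<n = <-≤-trans (toℕ<n t) (≤-trans (m≤m+n h h) h+h≤n)

  t+h<n : toℕ t + h < n
  t+h<n = <-≤-trans (+-monoˡ-< h (toℕ<n t)) h+h≤n

  mod≡ : ∀ {x} → x % h ≡ toℕ t % h → x mod h ≡ t
  mod≡ eq = toℕ-injective (trans (toℕ-fromℕ< _) (trans eq (m<n⇒m%n≡m (toℕ<n t))))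

mainTheorem8 : ∀ (m n : ℕ) → 2 ≤ n → 1 ≤ m → m ≤ 4 ^ (n / 2) → RCk≡ 2 (K3 m n n) 2
mainTheorem8 (suc m) n@(suc (suc _)) 2≤n@(s≤s (s≤s _)) (s≤s z≤n) m≤4^h =
  (colouring , rainbow2Connected) ,
  λ _ ℓ<2 → ℓ<2⇒¬RainbowKColourable (toFin-≢ {b zero} {c zero} λ ()) ≤-refl ℓ<2
  where
  h : ℕ
  h = n / 2

  instance
    h≢0 : NonZero h
    h≢0 = >-nonZero (m≥n⇒m/n>0 2≤n)

  h+h≤n : h + h ≤ n
  h+h≤n = subst (_≤ n) (trans (*-comm h 2) (cong (h +_) (+-identityʳ h))) (m/n*n≤m n 2)

  open Tripartite (suc m) n
  open TwoColouring (base4Code h) (base4Code-separates m≤4^h) zero (base4Code-zero {m} h)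
                    (λ i → toℕ i mod h) (mod-fibres h+h≤n)
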